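{- Let $T$ be a regular set of patterns. If $\pi^i$ is a directed permutation in $\mathcal{C}_n$ (with $\pi$ of length $n$ and $i\in\{0,1\}$), then any two successive permutations in the list $\phi(\pi^i)$ differ in at most three positions.
   Context: $\mathfrak{S}_n(T)$ is the set of permutations of $\{1,\ldots,n\}$ avoiding every pattern in $T$. The sites of $\pi\in\mathfrak{S}_n$ are the $n+1$ gaps between consecutive entries, before the first and after the last entry, numbered from right to left $1,\ldots,n+1$. For $\pi\in\mathfrak{S}_n(T)$, site $i$ is active if inserting $n+1$ into site $i$ gives a permutation in $\mathfrak{S}_{n+1}(T)$. $T$ is regular if for every $n\ge1$ and every $\pi\in\mathfrak{S}_n(T)$: $\pi$ has at least two active sites and they are right justified (every site to the right of an active site is active, so the active sites are $1,\ldots,k$); and the number of active sites of the permutation obtained by inserting $n+1$ into the $i$-th active site of $\pi$ depends only on $i$ and the number $k$ of active sites of $\pi$. A directed permutation is a pair $\pi^i$ of a permutation $\pi$ and a direction $i\in\{0,1\}$ ($1$ = up, $0$ = down). For $k\ge2$, let $L_k$ be $1,3,5,\ldots,k,k-1,k-3,\ldots,4,2$ if $k$ is odd and $1,3,5,\ldots,k-1,k,k-2,\ldots,4,2$ if $k$ is even. For $\pi\in\mathfrak{S}_n(T)$ with $k$ active sites, $\phi(\pi^1)$ is the list of $k$ directed permutations whose $j$-th element is $\pi$ with $n+1$ inserted into its $L_k(j)$-th active site, the first having direction $1$ and all others direction $0$; $\phi(\pi^0)$ is the reversal of $\phi(\pi^1)$ with every direction flipped. $\phi$ extends to lists by concatenation.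 Let $d_n=|\mathfrak{S}_n(T)|$, $\mathcal{C}_1=((1)^1)$, and $\mathcal{C}_n=\bigoplus_{q=1}^{d_{n-1}}\phi(\mathcal{C}_{n-1}(q))$ for $n\ge2$, where $\mathcal{C}_{n-1}(q)$ is the $q$-th entry. Two permutations differ in a position if their entries in that position are different (directions ignored). -}

module Defs where

open import Data.Bool using (Bool; true; false; not; _∧_; if_then_else_)
open import Data.Nat using (ℕ; zero; suc; _+_; _∸_; _≤_; _<ᵇ_; _≡ᵇ_; _%_)
open import Data.List using (List; []; _∷_; _++_; map; length; take; drop; applyUpTo; reverse; filter; concatMap; zipWith; sum; foldr)
open import Data.Bool.ListAction using (all; any)
open import Data.List.Relation.Binary.Permutation.Propositional using (_↭_)
open import Data.Product using (_×_; _,_; proj₁; proj₂; Σ; ∃)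
open import Relation.Binary.PropositionalEquality using (_≡_)

oneTo : ℕ → List ℕ
oneTo n = applyUpTo suc n

IsPerm : ℕ → List ℕ → Set
IsPerm n π = π ↭ oneTo n

orderIso : List ℕ → List ℕ → Bool
orderIso [] [] = true
orderIso [] (_ ∷ _) = false
orderIso (_ ∷ _) [] = false
orderIso (x ∷ xs) (y ∷ ys) =
  allPairs xs ys ∧ orderIso xs ys
  where
  allPairs : List ℕ → List ℕ → Bool
  allPairs [] [] = true
  allPairs (a ∷ as) (b ∷ bs) =
    (if (x <ᵇ a) then (y <ᵇ b) else not (y <ᵇ b))
    ∧ (if (a <ᵇ x) then (b <ᵇ y) else not (b <ᵇ y))
    ∧ allPairs as bs
  allPairs _ _ = false

subseqs : List ℕ → List (List ℕ)
subseqs [] = [] ∷ []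
subseqs (x ∷ xs) = map (x ∷_) (subseqs xs) ++ subseqs xs

contains : List ℕ → List ℕ → Bool
contains π τ = any (λ s → orderIso s τ) (subseqs π)

avoids : List (List ℕ) → List ℕ → Bool
avoids T π = all (λ τ → not (contains π τ)) T

InS : List (List ℕ) → ℕ → List ℕ → Set
InS T n π = IsPerm n π × avoids T π ≡ true

-- insert x into site i of π (sites numbered right to left 1..length π + 1;
-- site i has exactly i-1 entries to its right)
insAt : List ℕ → ℕ → ℕ → List ℕ
insAt π i x = take (length π + 1 ∸ i) π ++ x ∷ drop (length π + 1 ∸ i) π

ins : List ℕ → ℕ → List ℕ
ins π i = insAt π i (suc (length π))

active : List (List ℕ) → List ℕ → ℕ → Bool
active T π i = avoids T (ins π i)

activeSites : List (List ℕ) → List ℕ → List ℕ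
activeSites T π = filter (λ i → Data.Bool._≟_ (active T π i) true) (oneTo (suc (length π)))
  where import Data.Bool

nActive : List (List ℕ) → List ℕ → ℕ
nActive T π = length (activeSites T π)

-- 1-indexed lookup with default 0
nth : List ℕ → ℕ → ℕ
nth [] _ = 0
nth (x ∷ xs) zero = 0
nth (x ∷ xs) (suc zero) = x
nth (x ∷ xs) (suc (suc j)) = nth xs (suc j)

activeSite : List (List ℕ) → List ℕ → ℕ → ℕ
activeSite T π j = nth (activeSites T π) j

Regular : List (List ℕ) → Set
Regular T =
  (∀ n π → 1 ≤ n → InS T n π →
     2 ≤ nActive T π
     -- right justified: every site to the right of an active site is active
     × (∀ i j → 1 ≤ j → j ≤ i → i ≤ suc n → active T π i ≡ true → active T π j ≡ true))
  × Σ (ℕ → ℕ → ℕ) (λ f →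
      ∀ n π → 1 ≤ n → InS T n π → ∀ i → 1 ≤ i → i ≤ nActive T π →
        nActive T (ins π (activeSite T π i)) ≡ f i (nActive T π))

isOdd : ℕ → Bool
isOdd n = n % 2 ≡ᵇ 1

L : ℕ → List ℕ
L k = filter (λ m → Data.Bool._≟_ (isOdd m) true) (oneTo k)
      ++ reverse (filter (λ m → Data.Bool._≟_ (isOdd m) false) (oneTo k))
  where import Data.Bool

-- directed permutation: direction true = up (1), false = down (0)
DPerm : Set
DPerm = List ℕ × Bool

markFirst : List (List ℕ) → List DPerm
markFirst [] = []
markFirst (σ ∷ σs) = (σ , true) ∷ map (λ τ → (τ , false)) σs

flipDir : DPerm → DPerm
flipDir (σ , d) = (σ , not d)

φup : List (List ℕ) → List ℕ → List DPerm
φup T π = markFirst (map (λ j → ins π (activeSite T π j)) (L (nActive T π)))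

φ : List (List ℕ) → DPerm → List DPerm
φ T (π , true) = φup T π
φ T (π , false) = map flipDir (reverse (φup T π))

-- the list 𝒞_n (𝒞_0 is unused and set to the empty list)
C : List (List ℕ) → ℕ → List DPerm
C T zero = []
C T (suc zero) = ((1 ∷ []) , true) ∷ []
C T (suc (suc n)) = concatMap (φ T) (C T (suc n))

diffCount : List ℕ → List ℕ → ℕ
diffCount [] [] = 0
diffCount [] (_ ∷ ys) = suc (length ys)
diffCount (_ ∷ xs) [] = suc (length xs)
diffCount (x ∷ xs) (y ∷ ys) = (if x ≡ᵇ y then 0 else 1) + diffCount xs ys

-- Regularity makes the active sites of an avoiding π exactly 1, …, k, so φ(π^i) lists π with
-- n+1 inserted into the sites L_k(1), L_k(2), …, L_k(k) (or in the reverse order).  Consecutive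
-- entries of L_k differ by at most 2: the odd numbers ascend in steps of 2, the list turns at
-- k, k−1, and the even numbers descend in steps of 2.  Moving the inserted entry by d sites
-- changes at most d+1 positions, hence at most 3.  If π contains a pattern of T then so does
-- every insertion into π, so π has no active sites and φ(π^i) is empty.
module Submission where

open import Defs
open import Data.Bool using (Bool; true; false; not; if_then_else_)
import Data.Bool as Bool
open import Data.Bool.Properties using (not-¬; ¬-not; not-involutive; not-injective; T-≡)
open import Data.Nat using (ℕ; zero; suc; _+_; _∸_; _%_; _≤_; _<_; z≤n; s≤s; ∣_-_∣; _≡ᵇ_)
open import Data.Nat.Properties
open import Data.Nat.DivMod using ([m+n]%n≡m%n)
open import Data.List
  using (List; []; _∷_; _++_; _∷ʳ_; _ʳ++_; length; reverse; filter; take; drop; head; map; applyUpTo)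
open import Data.List.Properties
  using ( ʳ++-defn; reverse-involutive; reverse-++; reverse-map; filter-++; filter-accept; filter-reject
        ; filter-all; filter-none; applyUpTo-∷ʳ; length-applyUpTo; ++-identityʳ; take++drop≡id
        ; map-∘; map-id; map-++; map-cong-local)
open import Data.List.Membership.Propositional using (_∈_)
open import Data.List.Membership.Propositional.Properties
  using (∈-++⁻; ∈-filter⁻; ∈-applyUpTo⁻; ∈-map⁺; ∈-map⁻; ∈-concat⁻′)
open import Data.List.Relation.Unary.Any using (here)
import Data.List.Relation.Unary.Any.Properties as Any
import Data.List.Relation.Unary.All as All
open import Data.List.Relation.Unary.Linked as Linked using (Linked; []; [-]; _∷_; _∷′_; head′)
import Data.List.Relation.Unary.Linked.Properties as Linked
open import Data.List.Relation.Binary.Subset.Propositional using (_⊆_)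
open import Data.List.Relation.Binary.Subset.Propositional.Properties using (xs⊆ys++xs; ++⁺; map⁺; any⁺)
open import Data.List.Relation.Binary.Permutation.Propositional
  using (_↭_; prep; ↭-refl; module PermutationReasoning)
open import Data.List.Relation.Binary.Permutation.Propositional.Properties using (shift; ∷↭∷ʳ; ↭-length)
open import Data.Maybe using (just)
open import Data.Maybe.Relation.Binary.Connected as Connected
  using (Connected; just; just-nothing; nothing)
open import Data.Product using (_×_; _,_; proj₁; proj₂; ∃)
open import Data.Sum using (inj₁; inj₂)
open import Function using (_∘_; case_of_)
open import Function.Bundles using (Equivalence)
open import Relation.Binary.Definitions using (Symmetric)
open import Relation.Binary.PropositionalEquality
open import Relation.Nullary using (yes; no)
open import Relation.Unary using (Decidable)

module _ {A : Set} {R : A → A → Set} where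

  Linked-ʳ++⁺ : Symmetric R → ∀ {xs ys} → Linked R xs → Connected R (head xs) (head ys) →
                Linked R ys → Linked R (xs ʳ++ ys)
  Linked-ʳ++⁺ sym {[]}     _   _   Rys = Rys
  Linked-ʳ++⁺ sym {x ∷ xs} Rxs Rxy Rys =
    Linked-ʳ++⁺ sym (Linked.tail Rxs) (Connected.sym sym (head′ Rxs)) (Rxy ∷′ Rys)

  Linked-reverse⁺ : Symmetric R → ∀ {xs} → Linked R xs → Linked R (reverse xs)
  Linked-reverse⁺ sym {[]}    Rxs = Rxs
  Linked-reverse⁺ sym {x ∷ _} Rxs = Linked-ʳ++⁺ sym Rxs just-nothing []

  Linked-adjacent : ∀ xs {x y ys} → Linked R (xs ++ x ∷ y ∷ ys) → R x y
  Linked-adjacent []       (Rxy ∷ _) = Rxy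
  Linked-adjacent (_ ∷ xs) Rxs       = Linked-adjacent xs (Linked.tail Rxs)

m∸n∸[m∸o]≤o∸n : ∀ m {n o} → n ≤ o → (m ∸ n) ∸ (m ∸ o) ≤ o ∸ n
m∸n∸[m∸o]≤o∸n m {n} {o} n≤o = m≤n+o⇒m∸n≤o (m ∸ n) (m ∸ o) (begin
  m ∸ n                         ≤⟨ m≤n+m∸n (m ∸ n) (o ∸ n) ⟩
  (o ∸ n) + (m ∸ n ∸ (o ∸ n))   ≡⟨ cong (o ∸ n +_) (∸-+-assoc m n (o ∸ n)) ⟩
  (o ∸ n) + (m ∸ (n + (o ∸ n))) ≡⟨ cong (λ p → o ∸ n + (m ∸ p)) (m+[n∸m]≡n n≤o) ⟩
  (o ∸ n) + (m ∸ o)             ≡⟨ +-comm (o ∸ n) (m ∸ o) ⟩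
  (m ∸ o) + (o ∸ n)             ∎)
  where open ≤-Reasoning

∣m∸n-m∸o∣≤∣n-o∣ : ∀ m n o → ∣ m ∸ n - m ∸ o ∣ ≤ ∣ n - o ∣
∣m∸n-m∸o∣≤∣n-o∣ m n o with ≤-total n o
... | inj₁ n≤o = begin
  ∣ m ∸ n - m ∸ o ∣ ≡⟨ m≤n⇒∣n-m∣≡n∸m (∸-monoʳ-≤ m n≤o) ⟩
  (m ∸ n) ∸ (m ∸ o) ≤⟨ m∸n∸[m∸o]≤o∸n m n≤o ⟩
  o ∸ n             ≡⟨ m≤n⇒∣m-n∣≡n∸m n≤o ⟨
  ∣ n - o ∣         ∎
  where open ≤-Reasoning
... | inj₂ o≤n = begin
  ∣ m ∸ n - m ∸ o ∣ ≡⟨ m≤n⇒∣m-n∣≡n∸m (∸-monoʳ-≤ m o≤n) ⟩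
  (m ∸ o) ∸ (m ∸ n) ≤⟨ m∸n∸[m∸o]≤o∸n m o≤n ⟩
  n ∸ o             ≡⟨ m≤n⇒∣n-m∣≡n∸m o≤n ⟨
  ∣ n - o ∣         ∎
  where open ≤-Reasoning

≡ᵇ-refl : ∀ x → (x ≡ᵇ x) ≡ true
≡ᵇ-refl zero    = refl
≡ᵇ-refl (suc x) = ≡ᵇ-refl x

≡ᵇ-sym : ∀ x y → (x ≡ᵇ y) ≡ (y ≡ᵇ x)
≡ᵇ-sym zero    zero    = refl
≡ᵇ-sym zero    (suc y) = refl
≡ᵇ-sym (suc x) zero    = refl
≡ᵇ-sym (suc x) (suc y) = ≡ᵇ-sym x y

diffCount-refl : ∀ xs → diffCount xs xs ≡ 0
diffCount-refl []       = refl
diffCount-refl (x ∷ xs) rewrite ≡ᵇ-refl x = diffCount-refl xs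

diffCount-sym : ∀ xs ys → diffCount xs ys ≡ diffCount ys xs
diffCount-sym []       []       = refl
diffCount-sym []       (_ ∷ _)  = refl
diffCount-sym (_ ∷ _)  []       = refl
diffCount-sym (x ∷ xs) (y ∷ ys) rewrite ≡ᵇ-sym x y | diffCount-sym xs ys = refl

diffCount-∷-≤ : ∀ x y xs ys → diffCount (x ∷ xs) (y ∷ ys) ≤ suc (diffCount xs ys)
diffCount-∷-≤ x y xs ys = +-monoˡ-≤ (diffCount xs ys) (if≤1 (x ≡ᵇ y))
  where
  if≤1 : ∀ b → (if b then 0 else 1) ≤ 1
  if≤1 true  = z≤n
  if≤1 false = s≤s z≤n

-- Positions count from the left, whereas sites are numbered from the right:
-- ins π s = insertAt π (length π + 1 ∸ s) (suc (length π)).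
insertAt : List ℕ → ℕ → ℕ → List ℕ
insertAt xs p x = take p xs ++ x ∷ drop p xs

diffCount-∷-insertAt : ∀ y xs p x → diffCount (y ∷ xs) (insertAt xs p x) ≤ suc p
diffCount-∷-insertAt y xs zero x = begin
  diffCount (y ∷ xs) (x ∷ xs) ≤⟨ diffCount-∷-≤ y x xs xs ⟩
  suc (diffCount xs xs)       ≡⟨ cong suc (diffCount-refl xs) ⟩
  1                           ∎
  where open ≤-Reasoning
diffCount-∷-insertAt y []       (suc p) x = ≤-trans (diffCount-∷-≤ y x [] []) (s≤s z≤n)
diffCount-∷-insertAt y (z ∷ xs) (suc p) x =
  ≤-trans (diffCount-∷-≤ y z (z ∷ xs) (insertAt xs p x)) (s≤s (diffCount-∷-insertAt z xs p x))

diffCount-insertAt-≤ : ∀ xs x {p q} → p ≤ q → diffCount (insertAt xs p x) (insertAt xs q x) ≤ suc (q ∸ p)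
diffCount-insertAt-≤ xs       x {zero}  {q}     _         = diffCount-∷-insertAt x xs q x
diffCount-insertAt-≤ []       x {suc p} {suc q} _         rewrite ≡ᵇ-refl x = z≤n
diffCount-insertAt-≤ (y ∷ xs) x {suc p} {suc q} (s≤s p≤q) rewrite ≡ᵇ-refl y = diffCount-insertAt-≤ xs x p≤q

diffCount-insertAt : ∀ xs x p q → diffCount (insertAt xs p x) (insertAt xs q x) ≤ suc ∣ p - q ∣
diffCount-insertAt xs x p q with ≤-total p q
... | inj₁ p≤q = subst (λ d → diffCount (insertAt xs p x) (insertAt xs q x) ≤ suc d)
                   (sym (m≤n⇒∣m-n∣≡n∸m p≤q)) (diffCount-insertAt-≤ xs x p≤q)
... | inj₂ q≤p = subst₂ (λ c d → c ≤ suc d) (diffCount-sym (insertAt xs q x) (insertAt xs p x))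
                   (sym (m≤n⇒∣n-m∣≡n∸m q≤p)) (diffCount-insertAt-≤ xs x q≤p)

diffCount-ins : ∀ π s t → diffCount (ins π s) (ins π t) ≤ suc ∣ s - t ∣
diffCount-ins π s t = ≤-trans (diffCount-insertAt π (suc (length π)) (N ∸ s) (N ∸ t))
                              (s≤s (∣m∸n-m∸o∣≤∣n-o∣ N s t))
  where N = length π + 1

isOdd-2+ : ∀ k → isOdd (2 + k) ≡ isOdd k
isOdd-2+ k = cong (_≡ᵇ 1) (trans (cong (_% 2) (+-comm 2 k)) ([m+n]%n≡m%n k 2))

isOdd-suc : ∀ k → isOdd (suc k) ≡ not (isOdd k)
isOdd-suc zero          = refl
isOdd-suc (suc zero)    = refl
isOdd-suc (suc (suc k)) = begin
  isOdd (3 + k)       ≡⟨ isOdd-2+ (suc k) ⟩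
  isOdd (1 + k)       ≡⟨ isOdd-suc k ⟩
  not (isOdd k)       ≡⟨ cong not (isOdd-2+ k) ⟨
  not (isOdd (2 + k)) ∎
  where open ≡-Reasoning

isOdd-suc-≡ : ∀ k {b} → isOdd (suc k) ≡ b → isOdd k ≢ b
isOdd-suc-≡ k {b} e o≡b = not-¬ o≡b (begin
  isOdd k             ≡⟨ not-involutive (isOdd k) ⟨
  not (not (isOdd k)) ≡⟨ cong not (trans (sym (isOdd-suc k)) e) ⟩
  not b               ∎)
  where open ≡-Reasoning

isOdd-suc-≢ : ∀ k {b} → isOdd (suc k) ≢ b → isOdd k ≡ b
isOdd-suc-≢ k ne = not-injective (trans (sym (isOdd-suc k)) (¬-not ne))

filter-oneTo-suc : ∀ {P : ℕ → Set} (P? : Decidable P) k →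
  filter P? (oneTo (suc k)) ≡ filter P? (oneTo k) ++ filter P? (suc k ∷ [])
filter-oneTo-suc P? k = trans (cong (filter P?) (sym (applyUpTo-∷ʳ suc k))) (filter-++ P? (oneTo k) (suc k ∷ []))

ofParity? : ∀ b → Decidable (λ m → isOdd m ≡ b)
ofParity? b m = isOdd m Bool.≟ b

parityDesc : Bool → ℕ → List ℕ
parityDesc b k = reverse (filter (ofParity? b) (oneTo k))

parityDesc-suc : ∀ b k →
  parityDesc b (suc k) ≡ reverse (filter (ofParity? b) (suc k ∷ [])) ++ parityDesc b k
parityDesc-suc b k =
  trans (cong reverse (filter-oneTo-suc (ofParity? b) k)) (reverse-++ (filter (ofParity? b) (oneTo k)) _)

parityDesc-accept : ∀ {b} k → isOdd (suc k) ≡ b → parityDesc b (suc k) ≡ suc k ∷ parityDesc b k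
parityDesc-accept {b} k e = trans (parityDesc-suc b k)
  (cong (λ xs → reverse xs ++ parityDesc b k) (filter-accept (ofParity? b) {x = suc k} {xs = []} e))

parityDesc-reject : ∀ {b} k → isOdd (suc k) ≢ b → parityDesc b (suc k) ≡ parityDesc b k
parityDesc-reject {b} k ne = trans (parityDesc-suc b k)
  (cong (λ xs → reverse xs ++ parityDesc b k) (filter-reject (ofParity? b) {x = suc k} {xs = []} ne))

Near : ℕ → ℕ → Set
Near s t = ∣ s - t ∣ ≤ 2

Near-sym : Symmetric Near
Near-sym {s} {t} = subst (_≤ 2) (∣-∣-comm s t)

Near-suc : ∀ k → Near (suc k) k
Near-suc zero    = s≤s z≤n
Near-suc (suc k) = Near-suc k

Near-2+ : ∀ k → Near (2 + k) k
Near-2+ zero    = ≤-refl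
Near-2+ (suc k) = Near-2+ k

-- The largest element of parityDesc b k is then k − 1.
parityDesc-below : ∀ k b → isOdd k ≢ b → Linked Near (suc k ∷ parityDesc b k)
parityDesc-below zero          b _  = [-]
parityDesc-below (suc zero)    b ne = subst (λ xs → Linked Near (2 ∷ xs)) (sym (parityDesc-reject 0 ne)) [-]
parityDesc-below (suc (suc k)) b ne = subst (λ xs → Linked Near (3 + k ∷ xs))
  (sym (trans (parityDesc-reject (suc k) ne) (parityDesc-accept k (isOdd-suc-≢ (suc k) ne))))
  (Near-2+ (suc k) ∷ parityDesc-below k b (λ e → ne (trans (isOdd-2+ k) e)))

parityDesc-linked : ∀ k b → Linked Near (parityDesc b k)
parityDesc-linked zero    b = []
parityDesc-linked (suc k) b with isOdd (suc k) Bool.≟ b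
... | yes e  = subst (Linked Near) (sym (parityDesc-accept k e)) (parityDesc-below k b (isOdd-suc-≡ k e))
... | no  ne = subst (Linked Near) (sym (parityDesc-reject k ne)) (parityDesc-linked k b)

parityDesc-top : ∀ k b → Connected Near (just (suc k)) (head (parityDesc b k))
parityDesc-top zero    b = just-nothing
parityDesc-top (suc k) b with isOdd (suc k) Bool.≟ b
... | yes e  = subst (Connected Near (just (2 + k)) ∘ head) (sym (parityDesc-accept k e))
                   (just (Near-suc (suc k)))
... | no  ne = head′ (parityDesc-below (suc k) b ne)

parityDesc-junction : ∀ k → Connected Near (head (parityDesc true k)) (head (parityDesc false k))
parityDesc-junction zero    = nothing
parityDesc-junction (suc k) with isOdd (suc k) Bool.≟ true
... | yes e  = subst₂ (λ xs ys → Connected Near (head xs) (head ys))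
  (sym (parityDesc-accept k e)) (sym (parityDesc-reject k (λ e′ → not-¬ e′ e)))
  (parityDesc-top k false)
... | no  ne = subst₂ (λ xs ys → Connected Near (head xs) (head ys))
  (sym (parityDesc-reject k ne)) (sym (parityDesc-accept k (¬-not ne)))
  (Connected.sym {R = Near} (λ {s t} → Near-sym {s} {t}) (parityDesc-top k true))

L≡parityDesc-ʳ++ : ∀ k → L k ≡ parityDesc true k ʳ++ parityDesc false k
L≡parityDesc-ʳ++ k = sym (trans (ʳ++-defn (parityDesc true k))
  (cong (_++ parityDesc false k) (reverse-involutive (filter (ofParity? true) (oneTo k)))))

L-linked : ∀ k → Linked Near (L k)
L-linked k = subst (Linked Near) (sym (L≡parityDesc-ʳ++ k))
  (Linked-ʳ++⁺ (λ {s t} → Near-sym {s} {t})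
    (parityDesc-linked k true) (parityDesc-junction k) (parityDesc-linked k false))

∈-oneTo⁻ : ∀ {j k} → j ∈ oneTo k → 1 ≤ j × j ≤ k
∈-oneTo⁻ j∈ with ∈-applyUpTo⁻ suc j∈
... | _ , i<k , refl = s≤s z≤n , i<k

∈-L⁻ : ∀ {j} k → j ∈ L k → 1 ≤ j × j ≤ k
∈-L⁻ k j∈ with ∈-++⁻ (filter (ofParity? true) (oneTo k)) j∈
... | inj₁ j∈odd  = ∈-oneTo⁻ (proj₁ (∈-filter⁻ (ofParity? true) j∈odd))
... | inj₂ j∈even = ∈-oneTo⁻ (proj₁ (∈-filter⁻ (ofParity? false) (Any.reverse⁻ j∈even)))

holds? : (P : ℕ → Bool) → Decidable (λ i → P i ≡ true)
holds? P i = P i Bool.≟ true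

DownClosed : (ℕ → Bool) → ℕ → Set
DownClosed P m = ∀ i j → 1 ≤ j → j ≤ i → i ≤ m → P i ≡ true → P j ≡ true

filter-downClosed : ∀ P m → DownClosed P m →
  filter (holds? P) (oneTo m) ≡ oneTo (length (filter (holds? P) (oneTo m)))
filter-downClosed P zero    _  = refl
filter-downClosed P (suc m) dc with P (suc m) in e
... | true  = trans all-P (cong oneTo (sym (trans (cong length all-P) (length-applyUpTo suc (suc m)))))
  where
  all-P : filter (holds? P) (oneTo (suc m)) ≡ oneTo (suc m)
  all-P = filter-all (holds? P) (All.tabulate λ j∈ →
    dc (suc m) _ (proj₁ (∈-oneTo⁻ j∈)) (proj₂ (∈-oneTo⁻ j∈)) ≤-refl e)
... | false = trans drop-top (trans (filter-downClosed P m dc′) (cong (oneTo ∘ length) (sym drop-top)))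
  where
  dc′ : DownClosed P m
  dc′ i j 1≤j j≤i i≤m = dc i j 1≤j j≤i (m≤n⇒m≤1+n i≤m)
  drop-top : filter (holds? P) (oneTo (suc m)) ≡ filter (holds? P) (oneTo m)
  drop-top = trans (filter-oneTo-suc (holds? P) m)
    (trans (cong (filter (holds? P) (oneTo m) ++_)
                 (filter-reject (holds? P) {x = suc m} {xs = []} λ e′ → not-¬ e e′))
           (++-identityʳ _))

nth-applyUpTo : ∀ (f : ℕ → ℕ) k i → i < k → nth (applyUpTo f k) (suc i) ≡ f i
nth-applyUpTo f (suc k) zero    _         = refl
nth-applyUpTo f (suc k) (suc i) (s≤s i<k) = nth-applyUpTo (f ∘ suc) k i i<k

activeSite-downClosed : ∀ T π → DownClosed (active T π) (suc (length π)) →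
  ∀ {j} → 1 ≤ j → j ≤ nActive T π → activeSite T π j ≡ j
activeSite-downClosed T π dc {suc i} _ i<k = begin
  nth (activeSites T π) (suc i)      ≡⟨ cong (λ xs → nth xs (suc i)) (filter-downClosed (active T π) _ dc) ⟩
  nth (oneTo (nActive T π)) (suc i)  ≡⟨ nth-applyUpTo suc (nActive T π) i i<k ⟩
  suc i                              ∎
  where open ≡-Reasoning

subseqs-insertAt⁺ : ∀ xs p x → subseqs xs ⊆ subseqs (insertAt xs p x)
subseqs-insertAt⁺ xs       zero    x = xs⊆ys++xs (subseqs xs) (map (x ∷_) (subseqs xs))
subseqs-insertAt⁺ []       (suc p) x = xs⊆ys++xs (subseqs []) (map (x ∷_) (subseqs []))
subseqs-insertAt⁺ (y ∷ xs) (suc p) x = ++⁺ (map⁺ (y ∷_) IH) IH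
  where IH = subseqs-insertAt⁺ xs p x

contains-insertAt : ∀ xs p x τ → contains xs τ ≡ true → contains (insertAt xs p x) τ ≡ true
contains-insertAt xs p x τ c = Equivalence.to T-≡
  (any⁺ (λ s → orderIso s τ) (subseqs-insertAt⁺ xs p x) (Equivalence.from T-≡ c))

avoids-insertAt⁻ : ∀ Ts xs p x → avoids Ts (insertAt xs p x) ≡ true → avoids Ts xs ≡ true
avoids-insertAt⁻ []       xs p x _ = refl
avoids-insertAt⁻ (τ ∷ Ts) xs p x av with contains xs τ in c | contains (insertAt xs p x) τ in c′
... | true  | false = case trans (sym (contains-insertAt xs p x τ c)) c′ of λ ()
... | false | false = avoids-insertAt⁻ Ts xs p x av

nActive-nonAvoiding : ∀ T π → avoids T π ≡ false → nActive T π ≡ 0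
nActive-nonAvoiding T π av =
  cong length (filter-none (holds? (active T π)) {xs = oneTo (suc (length π))} (All.tabulate λ {s} _ act →
    not-¬ av (avoids-insertAt⁻ T π (length π + 1 ∸ s) (suc (length π)) act)))

ins-↭ : ∀ {n} σ s → σ ↭ oneTo n → ins σ s ↭ oneTo (suc n)
ins-↭ {n} σ s σ↭ = begin
  take p σ ++ x ∷ drop p σ  ↭⟨ shift x (take p σ) (drop p σ) ⟩
  x ∷ take p σ ++ drop p σ  ≡⟨ cong (x ∷_) (take++drop≡id p σ) ⟩
  x ∷ σ                     ↭⟨ prep x σ↭ ⟩
  x ∷ oneTo n               ↭⟨ ∷↭∷ʳ x (oneTo n) ⟩
  oneTo n ∷ʳ x              ≡⟨ cong (oneTo n ∷ʳ_) (cong suc |σ|≡n) ⟩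
  oneTo n ∷ʳ suc n          ≡⟨ applyUpTo-∷ʳ suc n ⟩
  oneTo (suc n)             ∎
  where
  open PermutationReasoning
  p = length σ + 1 ∸ s
  x = suc (length σ)
  |σ|≡n : length σ ≡ n
  |σ|≡n = trans (↭-length σ↭) (length-applyUpTo suc n)

children : List (List ℕ) → List ℕ → List (List ℕ)
children T π = map (λ j → ins π (activeSite T π j)) (L (nActive T π))

map-proj₁-markFirst : ∀ σs → map proj₁ (markFirst σs) ≡ σs
map-proj₁-markFirst []       = refl
map-proj₁-markFirst (σ ∷ σs) = cong (σ ∷_) (trans (sym (map-∘ σs)) (map-id σs))

map-proj₁-φ-up : ∀ T π → map proj₁ (φ T (π , true)) ≡ children T π
map-proj₁-φ-up T π = map-proj₁-markFirst (children T π)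

map-proj₁-φ-down : ∀ T π → map proj₁ (φ T (π , false)) ≡ reverse (children T π)
map-proj₁-φ-down T π = begin
  map proj₁ (map flipDir (reverse (φup T π))) ≡⟨ map-∘ (reverse (φup T π)) ⟨
  map proj₁ (reverse (φup T π))               ≡⟨ reverse-map proj₁ (φup T π) ⟩
  reverse (map proj₁ (φup T π))               ≡⟨ cong reverse (map-proj₁-φ-up T π) ⟩
  reverse (children T π)                      ∎
  where open ≡-Reasoning

∈-map-proj₁-φ⁻ : ∀ T σ d {τ} → τ ∈ map proj₁ (φ T (σ , d)) → τ ∈ children T σ
∈-map-proj₁-φ⁻ T σ true  = subst (_ ∈_) (map-proj₁-φ-up T σ)
∈-map-proj₁-φ⁻ T σ false = Any.reverse⁻ ∘ subst (_ ∈_) (map-proj₁-φ-down T σ)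

∈-φ⁻ : ∀ T σ d {τ} → τ ∈ φ T (σ , d) → ∃ λ s → proj₁ τ ≡ ins σ s
∈-φ⁻ T σ d τ∈ with ∈-map⁻ _ (∈-map-proj₁-φ⁻ T σ d (∈-map⁺ proj₁ τ∈))
... | j , _ , eq = activeSite T σ j , eq

∈-C⁻ : ∀ T m {τ} → τ ∈ C T (suc m) → proj₁ τ ↭ oneTo (suc m)
∈-C⁻ T zero    (here refl) = ↭-refl
∈-C⁻ T (suc m) τ∈ with ∈-concat⁻′ (map (φ T) (C T (suc m))) τ∈
... | _ , τ∈φ , φ∈ with ∈-map⁻ (φ T) φ∈
... | (σ , d) , σ∈ , refl with ∈-φ⁻ T σ d τ∈φ
... | s , eq = subst (_↭ oneTo (suc (suc m))) (sym eq) (ins-↭ σ s (∈-C⁻ T m σ∈))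

Close : List ℕ → List ℕ → Set
Close σ τ = diffCount σ τ ≤ 3

Close-sym : Symmetric Close
Close-sym {σ} {τ} = subst (_≤ 3) (diffCount-sym σ τ)

children-linked : ∀ T → Regular T → ∀ m π → π ↭ oneTo (suc m) → Linked Close (children T π)
children-linked T reg m π π↭ with avoids T π in av
... | false = subst (λ k → Linked Close (map (λ j → ins π (activeSite T π j)) (L k)))
                    (sym (nActive-nonAvoiding T π av)) []
... | true  = subst (Linked Close) (sym children≡)
                    (Linked.map⁺ (Linked.map (λ {s t} → near⇒close {s} {t}) (L-linked k)))
  where
  k = nActive T π
  rightJustified : DownClosed (active T π) (suc (length π))
  rightJustified = subst (DownClosed (active T π) ∘ suc)
    (sym (trans (↭-length π↭) (length-applyUpTo suc (suc m))))
    (proj₂ (proj₁ reg (suc m) π (s≤s z≤n) (π↭ , av)))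
  children≡ : children T π ≡ map (ins π) (L k)
  children≡ = map-cong-local (All.tabulate λ j∈ →
    cong (ins π) (activeSite-downClosed T π rightJustified (proj₁ (∈-L⁻ k j∈)) (proj₂ (∈-L⁻ k j∈))))
  near⇒close : ∀ {s t} → Near s t → Close (ins π s) (ins π t)
  near⇒close {s} {t} s~t = ≤-trans (diffCount-ins π s t) (s≤s s~t)

φ-linked : ∀ T → Regular T → ∀ m π d → (π , d) ∈ C T (suc m) → Linked Close (map proj₁ (φ T (π , d)))
φ-linked T reg m π true  π∈ = subst (Linked Close) (sym (map-proj₁-φ-up T π))
  (children-linked T reg m π (∈-C⁻ T m π∈))
φ-linked T reg m π false π∈ = subst (Linked Close) (sym (map-proj₁-φ-down T π))
  (Linked-reverse⁺ (λ {σ τ} → Close-sym {σ} {τ}) (children-linked T reg m π (∈-C⁻ T m π∈)))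

lemma4p2 : (T : List (List ℕ)) → Regular T →
    (n : ℕ) (π : List ℕ) (i : Bool) → (π , i) ∈ C T n →
    (xs ys : List DPerm) (a b : DPerm) → φ T (π , i) ≡ xs ++ a ∷ b ∷ ys →
    diffCount (proj₁ a) (proj₁ b) ≤ 3
lemma4p2 T reg zero    π i ()
lemma4p2 T reg (suc m) π i π∈ xs ys a b φ≡ = Linked-adjacent (map proj₁ xs)
  (subst (Linked Close) (trans (cong (map proj₁) φ≡) (map-++ proj₁ xs (a ∷ b ∷ ys)))
    (φ-linked T reg m π i π∈))
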